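{- Let $n$ be a positive integer. The elements of $\mathsf{K}(n)$ are exactly the bipartitions of $[n]$ without isolated points.
   Context: $[n]=\{1,\dots,n\}$. $\mathrm{Bip}(n)$ is the set of bipartitions of $[n]$, i.e. transitive relations $\mathbf{x}\subseteq[n]\times[n]$ whose complement in $[n]\times[n]$ is also transitive, ordered by inclusion; it is a lattice whose join is the transitive closure of the union and whose least element is $\varnothing$. $\mathsf{G}(n)$ is the set of all $([n]\setminus U)\times U$ with $\varnothing\neq U\subsetneq[n]$, and $\mathsf{K}(n)$ is the $(\vee,0)$-subsemilattice of $\mathrm{Bip}(n)$ generated by $\mathsf{G}(n)$ (i.e. all joins in $\mathrm{Bip}(n)$ of finite subsets of $\mathsf{G}(n)$, including the empty join $\varnothing$). An element $a\in[n]$ is an isolated point of a bipartition $\mathbf{x}$ if for each $i\in[n]$: ($(a,i)\in\mathbf{x}$ and $(i,a)\in\mathbf{x}$) iff $i=a$. -}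

module Defs where

open import Data.Bool using (Bool; true; false)
open import Data.Nat using (ℕ)
open import Data.Fin using (Fin)
open import Data.Fin.Subset using (Subset; _∈_; _∉_; Nonempty)
open import Data.List using (List; []; _∷_)
open import Data.Product using (_×_; ∃; ∃-syntax)
open import Data.Sum using (_⊎_)
open import Data.Empty using (⊥)
open import Data.Unit using (⊤)
open import Relation.Nullary using (¬_)
open import Relation.Binary.PropositionalEquality using (_≡_)
open import Relation.Binary.Construct.Closure.Transitive using (TransClosure)

BRel : ℕ → Set
BRel n = Fin n → Fin n → Bool

Transitive : ∀ {n} → BRel n → Set
Transitive x = ∀ i j k → x i j ≡ true → x j k ≡ true → x i k ≡ true

CoTransitive : ∀ {n} → BRel n → Set
CoTransitive x = ∀ i j k → x i j ≡ false → x j k ≡ false → x i k ≡ false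

IsBip : ∀ {n} → BRel n → Set
IsBip x = Transitive x × CoTransitive x

ProperNonempty : ∀ {n} → Subset n → Set
ProperNonempty {n} U = Nonempty U × ∃[ i ] (i ∉ U)

Gen : ∀ {n} → Subset n → Fin n → Fin n → Set
Gen U i j = (i ∉ U) × (j ∈ U)

-- Join in Bip(n) of the generators indexed by a finite list of subsets:
-- the empty join is ∅, and  join (U ∷ Us) = transitive closure of (Gen U ∪ join Us).
JoinGen : ∀ {n} → List (Subset n) → Fin n → Fin n → Set
JoinGen []       i j = ⊥
JoinGen (U ∷ Us) i j = TransClosure (λ a b → Gen U a b ⊎ JoinGen Us a b) i j

AllProper : ∀ {n} → List (Subset n) → Set
AllProper []       = ⊤
AllProper (U ∷ Us) = ProperNonempty U × AllProper Us

-- x ∈ K(n): x is the join of finitely many elements of G(n)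
InK : ∀ {n} → BRel n → Set
InK {n} x = ∃[ Us ] (AllProper Us × (∀ i j → (x i j ≡ true → JoinGen Us i j) × (JoinGen Us i j → x i j ≡ true)))

Isolated : ∀ {n} → BRel n → Fin n → Set
Isolated x a = ∀ i → ((x a i ≡ true × x i a ≡ true) → i ≡ a) × (i ≡ a → (x a i ≡ true × x i a ≡ true))

NoIsolated : ∀ {n} → BRel n → Set
NoIsolated x = ∀ a → ¬ Isolated x a

module Submission where

-- Write  E_Us  for the union of the generators ([n]∖U) × U, U ∈ Us.  The join
-- JoinGen Us is the transitive closure of E_Us, and E_Us has two properties:
-- it is irreflexive, and it "splits": an edge a → b factors through every j
-- as a → j or j → b (j lies in U or not).  Splitting passes to transitive
-- closures, and then
--   (⊆)  any x represented by the closure of an irreflexive splitting relation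
--        is transitive, has transitive complement (by splitting) and no
--        isolated point (a loop a → c → … → a must leave a, and c ≠ a would
--        then be mutually related to a);
--   (⊇)  for a bipartition x without isolated points take the strict up-sets
--        U_i = { b ≠ i | x i b }.  Cotransitivity of x makes every generator
--        edge of U_i an edge of x, every off-diagonal pair (i , j) of x is such
--        an edge, and a diagonal pair (i , i) is a two-step loop through a
--        point k ≠ i mutually related to i, which exists as i is not isolated.

open import Defs
open import Data.Nat using (ℕ; _≤_)
open import Data.Product using (_×_; _,_; proj₁; proj₂; ∃-syntax)
open import Data.Sum using (_⊎_; inj₁; inj₂)
open import Data.Bool using (true; false; _∧_)
import Data.Bool as Bool
open import Data.Fin using (Fin; _≟_)
open import Data.Fin.Properties using (any?)
open import Data.Fin.Subset using (Subset; _∈_; _∉_)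
open import Data.Fin.Subset.Properties using (_∈?_; nonempty?)
open import Data.Vec using (tabulate)
open import Data.Vec.Properties using (lookup∘tabulate; []=⇒lookup; lookup⇒[]=)
open import Data.List using (List; []; _∷_; map; filter; allFin)
open import Data.List.Relation.Unary.Any using (Any; here; there)
open import Data.List.Membership.Propositional using (lose; find) renaming (_∈_ to _∈ₗ_)
open import Data.List.Membership.Propositional.Properties using (∈-map⁺; ∈-map⁻; ∈-filter⁺; ∈-filter⁻; ∈-allFin)
open import Relation.Binary.Construct.Closure.Transitive using (TransClosure; [_]; _∷_; _++_)
open import Relation.Binary.PropositionalEquality using (_≡_; _≢_; refl; sym; trans; subst)
open import Relation.Nullary using (¬_; yes; no; contradiction)
open import Relation.Nullary.Decidable using (isNo; _×-dec_; ¬?)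
open import Data.Unit using (tt)

Rel : ℕ → Set₁
Rel n = Fin n → Fin n → Set

Represents : ∀ {n} → BRel n → Rel n → Set
Represents x R = ∀ i j → (x i j ≡ true → R i j) × (R i j → x i j ≡ true)

false≢true : ∀ {b} → b ≡ false → b ≡ true → ∀ {A : Set} → A
false≢true refl ()

mapClosure : ∀ {n} {R S : Rel n} → (∀ {a b} → R a b → S a b) →
             ∀ {a b} → TransClosure R a b → TransClosure S a b
mapClosure f [ r ]    = [ f r ]
mapClosure f (r ∷ rs) = f r ∷ mapClosure f rs

Splits : ∀ {n} → Rel n → Set
Splits R = ∀ {a b} j → R a b → R a j ⊎ R j b

closure-splits : ∀ {n} {R : Rel n} → Splits R → Splits (TransClosure R)
closure-splits split j [ r ] with split j r
... | inj₁ r₁ = inj₁ [ r₁ ]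
... | inj₂ r₂ = inj₂ [ r₂ ]
closure-splits split j (r ∷ rs) with split j r
... | inj₁ r₁ = inj₁ [ r₁ ]
... | inj₂ r₂ = inj₂ (r₂ ∷ rs)

GenUnion : ∀ {n} → List (Subset n) → Rel n
GenUnion Us a b = Any (λ U → Gen U a b) Us

genUnion-irreflexive : ∀ {n} (Us : List (Subset n)) {a} → ¬ GenUnion Us a a
genUnion-irreflexive (U ∷ Us) (here (a∉U , a∈U)) = a∉U a∈U
genUnion-irreflexive (U ∷ Us) (there e)          = genUnion-irreflexive Us e

genUnion-splits : ∀ {n} {Us : List (Subset n)} → Splits (GenUnion Us)
genUnion-splits j (here (a∉U , b∈U)) with j ∈? _
... | yes j∈U = inj₁ (here (a∉U , j∈U))
... | no  j∉U = inj₂ (here (j∉U , b∈U))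
genUnion-splits j (there e) with genUnion-splits j e
... | inj₁ e₁ = inj₁ (there e₁)
... | inj₂ e₂ = inj₂ (there e₂)

join⇒closure : ∀ {n} (Us : List (Subset n)) {a b} →
               JoinGen Us a b → TransClosure (GenUnion Us) a b
join⇒closure (U ∷ Us) [ inj₁ g ]      = [ here g ]
join⇒closure (U ∷ Us) [ inj₂ p ]      = mapClosure there (join⇒closure Us p)
join⇒closure (U ∷ Us) (inj₁ g ∷ rest) = here g ∷ join⇒closure (U ∷ Us) rest
join⇒closure (U ∷ Us) (inj₂ p ∷ rest) =
  mapClosure there (join⇒closure Us p) ++ join⇒closure (U ∷ Us) rest

genUnion⇒join : ∀ {n} (Us : List (Subset n)) {a b} → GenUnion Us a b → JoinGen Us a b
genUnion⇒join (U ∷ Us) (here g)  = [ inj₁ g ]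
genUnion⇒join (U ∷ Us) (there e) = [ inj₂ (genUnion⇒join Us e) ]

closure⇒join : ∀ {n} (Us : List (Subset n)) {a b} →
               TransClosure (GenUnion Us) a b → JoinGen Us a b
closure⇒join []       [ () ]
closure⇒join []       (() ∷ _)
closure⇒join (U ∷ Us) [ e ]      = genUnion⇒join (U ∷ Us) e
closure⇒join (U ∷ Us) (e ∷ rest) = genUnion⇒join (U ∷ Us) e ++ closure⇒join (U ∷ Us) rest

module ClosureOfSplitting {n} (x : BRel n) (R : Rel n)
  (irreflexive : ∀ {a} → ¬ R a a) (split : Splits R)
  (rep : Represents x (TransClosure R)) where

  path : ∀ {i j} → x i j ≡ true → TransClosure R i j
  path {i} {j} = proj₁ (rep i j)

  related : ∀ {i j} → TransClosure R i j → x i j ≡ true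
  related {i} {j} = proj₂ (rep i j)

  transitive : Transitive x
  transitive i j k xij xjk = related (path xij ++ path xjk)

  -- If x i k held, its path would pass through j, making x i j or x j k true.
  cotransitive : CoTransitive x
  cotransitive i j k xij≡f xjk≡f with x i k in xik
  ... | false = refl
  ... | true with closure-splits split j (path xik)
  ...   | inj₁ pij = false≢true xij≡f (related pij)
  ...   | inj₂ pjk = false≢true xjk≡f (related pjk)

  -- An isolated a has x a a, i.e. an R-loop a → c → … → a; then x a c and
  -- x c a force c ≡ a, so its first step a → a contradicts irreflexivity.
  noIsolated : NoIsolated x
  noIsolated a isolated with path (proj₁ (proj₂ (isolated a) refl))
  ... | [ r ] = irreflexive r
  ... | _∷_ {y = c} r rest =
    irreflexive (subst (R a) (proj₁ (isolated c) (related [ r ] , related rest)) r)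

inK⇒bipNoIsolated : ∀ {n} (x : BRel n) → InK x → IsBip x × NoIsolated x
inK⇒bipNoIsolated x (Us , _ , rep) = (transitive , cotransitive) , noIsolated
  where
  open ClosureOfSplitting x (GenUnion Us) (genUnion-irreflexive Us) genUnion-splits
    (λ i j → (λ p → join⇒closure Us (proj₁ (rep i j) p)) ,
             (λ t → proj₂ (rep i j) (closure⇒join Us t)))

allProper : ∀ {n} (Vs : List (Subset n)) → (∀ {U} → U ∈ₗ Vs → ProperNonempty U) → AllProper Vs
allProper []       _      = tt
allProper (V ∷ Vs) proper = proper (here refl) , allProper Vs (λ U∈ → proper (there U∈))

loopPartner : ∀ {n} (x : BRel n) {a} → ¬ Isolated x a → x a a ≡ true →
              ∃[ k ] (x a k ≡ true × x k a ≡ true × k ≢ a)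
loopPartner x {a} notIsolated xaa
  with any? (λ k → (x a k Bool.≟ true) ×-dec (x k a Bool.≟ true) ×-dec ¬? (k ≟ a))
... | yes partner = partner
... | no noPartner = contradiction isolated notIsolated
  where
  onlyItself : ∀ i → x a i ≡ true × x i a ≡ true → i ≡ a
  onlyItself i (xai , xia) with i ≟ a
  ... | yes i≡a = i≡a
  ... | no  i≢a = contradiction (i , xai , xia , i≢a) noPartner

  isolated : Isolated x a
  isolated i = onlyItself i , λ { refl → xaa , xaa }

module UpSets {n} (x : BRel n) (isBip : IsBip x) (noIsolated : NoIsolated x) where

  UpSet : Fin n → Subset n
  UpSet i = tabulate (λ b → x i b ∧ isNo (b ≟ i))

  ∈UpSet : ∀ {i b} → x i b ≡ true → b ≢ i → b ∈ UpSet i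
  ∈UpSet {i} {b} xib b≢i = lookup⇒[]= b (UpSet i) (trans (lookup∘tabulate _ b) holds)
    where
    holds : x i b ∧ isNo (b ≟ i) ≡ true
    holds with b ≟ i
    ... | yes b≡i = contradiction b≡i b≢i
    ... | no  _   rewrite xib = refl

  ∈UpSet⁻ : ∀ {i b} → b ∈ UpSet i → x i b ≡ true × b ≢ i
  ∈UpSet⁻ {i} {b} b∈ = unfold (trans (sym (lookup∘tabulate _ b)) ([]=⇒lookup b∈))
    where
    unfold : x i b ∧ isNo (b ≟ i) ≡ true → x i b ≡ true × b ≢ i
    unfold h with x i b | b ≟ i
    unfold () | false | _
    unfold () | true  | yes _
    ... | true | no b≢i = refl , b≢i

  ∉UpSet : ∀ i → i ∉ UpSet i
  ∉UpSet i i∈ = proj₂ (∈UpSet⁻ i∈) refl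

  -- Generator edges of U_i are edges of x: if x i a failed, cotransitivity
  -- would refute x i b; if x i a holds, a ∉ U_i forces a ≡ i.
  upSet-sound : ∀ i {a b} → a ∉ UpSet i → b ∈ UpSet i → x a b ≡ true
  upSet-sound i {a} {b} a∉ b∈ with ∈UpSet⁻ b∈ | x i a in xia
  ... | xib , _ | false with x a b in xab
  ...   | true  = refl
  ...   | false = false≢true (proj₂ isBip i a b xia xab) xib
  upSet-sound i {a} {b} a∉ b∈ | xib , _ | true with a ≟ i
  ...   | yes refl = xib
  ...   | no  a≢i  = contradiction (∈UpSet xia a≢i) a∉

  upSets : List (Subset n)
  upSets = map UpSet (filter (λ i → nonempty? (UpSet i)) (allFin n))

  upSet-proper : ∀ {U} → U ∈ₗ upSets → ProperNonempty U
  upSet-proper U∈ with ∈-map⁻ UpSet U∈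
  ... | i , i∈ , refl =
    proj₂ (∈-filter⁻ (λ i → nonempty? (UpSet i)) {xs = allFin n} i∈) , i , ∉UpSet i

  edge-sound : ∀ {a b} → GenUnion upSets a b → x a b ≡ true
  edge-sound e with find e
  ... | U , U∈ , (a∉ , b∈) with ∈-map⁻ UpSet U∈
  ...   | i , _ , refl = upSet-sound i a∉ b∈

  closure-sound : ∀ {a b} → TransClosure (GenUnion upSets) a b → x a b ≡ true
  closure-sound [ e ]      = edge-sound e
  closure-sound (e ∷ rest) = proj₁ isBip _ _ _ (edge-sound e) (closure-sound rest)

  edge-complete : ∀ {i j} → x i j ≡ true → i ≢ j → GenUnion upSets i j
  edge-complete {i} {j} xij i≢j =
    lose (∈-map⁺ UpSet (∈-filter⁺ (λ i → nonempty? (UpSet i)) (∈-allFin i) (j , j∈)))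
         (∉UpSet i , j∈)
    where j∈ = ∈UpSet xij (λ j≡i → i≢j (sym j≡i))

  closure-complete : ∀ i j → x i j ≡ true → TransClosure (GenUnion upSets) i j
  closure-complete i j xij with i ≟ j
  ... | no i≢j = [ edge-complete xij i≢j ]
  ... | yes refl with loopPartner x (noIsolated i) xij
  ...   | k , xik , xki , k≢i = edge-complete xik (λ i≡k → k≢i (sym i≡k)) ∷ [ edge-complete xki k≢i ]

  inK : InK x
  inK = upSets , allProper upSets upSet-proper ,
        λ i j → (λ xij → closure⇒join upSets (closure-complete i j xij)) ,
                (λ p → closure-sound (join⇒closure upSets p))

proposition9p4 : (n : ℕ) → 1 ≤ n → (x : BRel n) → (InK x → IsBip x × NoIsolated x) × (IsBip x × NoIsolated x → InK x)
proposition9p4 n _ x = inK⇒bipNoIsolated x , λ { (isBip , noIsolated) → UpSets.inK x isBip noIsolated }
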